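{- Let $G,H$ be $I$-filtered groups (for some ordering $I$). For each $i \in I$ let $E_i$ be a set of generators of $H_i$. Then a map $g : H \to G$ is polynomial if and only if $$\partial_{h_1}\cdots\partial_{h_m} g(n) \in G_{i_1+\dots+i_m}$$ for all $m \geq 0$, all $i_1,\dots,i_m \in I$, all $h_j \in E_{i_j}$ ($j=1,\dots,m$), and all $n \in H_0$.
   Context: An ordering is a set $I$ with a partial order $\prec$, a commutative associative operation $+$ with identity $0$, such that $0$ is the minimal element, $i\prec j$ implies $i+k\prec j+k$, and each initial segment $\{i : i \prec d\}$ is finite. An $I$-filtration of $G$ is a family $G_I = (G_i)_{i\in I}$ of subgroups with $G_i \supseteq G_j$ whenever $i\prec j$ and $[G_i,G_j]\subseteq G_{i+j}$ (with $[x,y]=x^{ -1}y^{ -1}xy$). For $g : H \to G$ and $h\in H$, $\partial_h g(n) := g(hn)g(n)^{ -1}$. A map $g : H\to G$ is polynomial if $\partial_{h_1}\cdots\partial_{h_m} g(n) \in G_{i_1+\dots+i_m}$ for all $m\geq 0$, all $i_1,\dots,i_m \in I$, all $h_j \in H_{i_j}$ and all $n\in H_0$. -}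

module Defs where

open import Level using (Level; _⊔_; suc)
open import Data.Product using (_×_; _,_; proj₁; proj₂; ∃)
open import Data.List using (List; []; _∷_; foldr)
open import Data.List.Membership.Propositional using (_∈_)
open import Data.List.Relation.Unary.All using (All)
open import Relation.Unary using (Pred)
open import Relation.Binary.PropositionalEquality using (_≡_)
open import Relation.Binary.Structures using (IsPartialOrder)
open import Algebra.Bundles using (Group)

record Ordering (o r : Level) : Set (suc (o ⊔ r)) where
  infixl 6 _+_
  infix 4 _≼_
  field
    Carrier        : Set o
    _≼_            : Carrier → Carrier → Set r
    _+_            : Carrier → Carrier → Carrier
    0#             : Carrier
    isPartialOrder : IsPartialOrder _≡_ _≼_
    +-assoc        : ∀ i j k → (i + j) + k ≡ i + (j + k)
    +-comm         : ∀ i j → i + j ≡ j + i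
    +-identityˡ    : ∀ i → 0# + i ≡ i
    0-minimal      : ∀ i → 0# ≼ i
    +-mono         : ∀ {i j} k → i ≼ j → (i + k) ≼ (j + k)
    initial-finite : ∀ d → ∃ λ (xs : List Carrier) → ∀ i → i ≼ d → i ∈ xs

module _ {c ℓ : Level} (G : Group c ℓ) where
  open Group G

  commutator : Carrier → Carrier → Carrier
  commutator x y = x ⁻¹ ∙ y ⁻¹ ∙ x ∙ y

  record IsSubgroup {p : Level} (K : Pred Carrier p) : Set (c ⊔ ℓ ⊔ p) where
    field
      resp  : ∀ {x y} → x ≈ y → K x → K y
      ε∈    : K ε
      ∙∈    : ∀ {x y} → K x → K y → K (x ∙ y)
      ⁻¹∈   : ∀ {x} → K x → K (x ⁻¹)

  data Generated {q : Level} (E : Pred Carrier q) : Pred Carrier (c ⊔ ℓ ⊔ q) where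
    gen  : ∀ {x} → E x → Generated E x
    unit : Generated E ε
    mul  : ∀ {x y} → Generated E x → Generated E y → Generated E (x ∙ y)
    inv  : ∀ {x} → Generated E x → Generated E (x ⁻¹)
    resp : ∀ {x y} → x ≈ y → Generated E x → Generated E y

  Generates : {p q : Level} → Pred Carrier q → Pred Carrier p → Set (c ⊔ ℓ ⊔ p ⊔ q)
  Generates E K = (∀ {x} → K x → Generated E x) × (∀ {x} → Generated E x → K x)

module _ {o r : Level} (I : Ordering o r) where
  open Ordering I renaming (Carrier to Idx; _+_ to _⊕_)

  record Filtration {c ℓ : Level} (G : Group c ℓ) (p : Level)
         : Set (o ⊔ r ⊔ c ⊔ ℓ ⊔ suc p) where
    open Group G
    field
      F           : Idx → Pred Carrier p
      isSubgroup  : ∀ i → IsSubgroup G (F i)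
      antitone    : ∀ {i j} → i ≼ j → ∀ {x} → F j x → F i x
      commutators : ∀ {i j x y} → F i x → F j y → F (i ⊕ j) (commutator G x y)

  indexSum : ∀ {a} {A : Set a} → List (Idx × A) → Idx
  indexSum = foldr (λ ih s → proj₁ ih ⊕ s) 0#

module _ {c₁ ℓ₁ c₂ ℓ₂ : Level} (H : Group c₁ ℓ₁) (G : Group c₂ ℓ₂) where
  private
    module G = Group G
    module H = Group H

  ∂ : H.Carrier → (H.Carrier → G.Carrier) → H.Carrier → G.Carrier
  ∂ h g n = g (h H.∙ n) G.∙ (g n) G.⁻¹

  ∂s : ∀ {a} {A : Set a} → List (A × H.Carrier) → (H.Carrier → G.Carrier) → H.Carrier → G.Carrier
  ∂s []              g = g
  ∂s ((_ , h) ∷ ihs) g = ∂ h (∂s ihs g)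

module _ {o r c₁ ℓ₁ c₂ ℓ₂ p₁ p₂ : Level} (I : Ordering o r)
         {H : Group c₁ ℓ₁} {G : Group c₂ ℓ₂}
         (FH : Filtration I H p₁) (FG : Filtration I G p₂) where
  open Ordering I using (0#) renaming (Carrier to Idx)
  private
    module G = Group G
    module H = Group H

  DerivCondition : ∀ {q} → (Idx → Pred H.Carrier q) → (H.Carrier → G.Carrier) → Set _
  DerivCondition S g =
    ∀ (ihs : List (Idx × H.Carrier)) → All (λ ih → S (proj₁ ih) (proj₂ ih)) ihs →
    ∀ n → Filtration.F FH 0# n →
    Filtration.F FG (indexSum I ihs) (∂s H G ihs g n)

  IsPolynomial : (H.Carrier → G.Carrier) → Set _
  IsPolynomial g = DerivCondition (Filtration.F FH) g

module Submission where

-- One direction is immediate, since every generator of H_i lies in H_i.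
-- For the other we work with a depth-indexed notion: Poly S 0 t f always
-- holds, and Poly S (m+1) t f says that f maps H₀ into G_t and that for
-- every direction h ∈ S_i the derivative ∂_h f satisfies Poly S m (t+i).

open import Defs
open import Level using (Level; _⊔_)
open import Relation.Unary using (Pred)
open import Function.Bundles using (_⇔_; mk⇔; Equivalence)
open Equivalence using (to; from)
open import Algebra.Bundles using (Group; CommutativeSemigroup)
open import Data.Nat using (ℕ; zero; suc)
open import Data.Fin using (Fin) renaming (zero to fzero; suc to fsuc)
import Data.Fin.Properties as Fin
open import Data.Bool using (Bool; true; false; not)
import Data.Bool.Properties as Bool
open import Data.Vec using (Vec; lookup; []; _∷_)
open import Data.List using (List; []; _∷_; _∷ʳ_; foldr)
open import Data.List.Reverse using (Reverse; []; _∶_∶ʳ_; reverseView)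
open import Data.List.Relation.Unary.All using (All; []; _∷_) renaming (map to All-map)
open import Data.List.Relation.Unary.All.Properties using (∷ʳ⁺; ∷ʳ⁻)
open import Data.Product using (_×_; _,_; proj₁; proj₂)
open import Data.Unit.Polymorphic using (⊤; tt)
open import Relation.Nullary using (yes; no)
open import Relation.Binary.PropositionalEquality as P
  using (_≡_; subst; subst₂; cong; cong₂; cong-app)

infixl 7 _·_
infix 8 _′
data Expr (n : ℕ) : Set where
  var : Fin n → Expr n
  one : Expr n
  _·_ : Expr n → Expr n → Expr n
  _′  : Expr n → Expr n

x₀ : ∀ {n} → Expr (suc n)
x₀ = var fzero
x₁ : ∀ {n} → Expr (suc (suc n))
x₁ = var (fsuc fzero)
x₂ : ∀ {n} → Expr (suc (suc (suc n)))
x₂ = var (fsuc (fsuc fzero))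
x₃ : ∀ {n} → Expr (suc (suc (suc (suc n))))
x₃ = var (fsuc (fsuc (fsuc fzero)))

[_,_] : ∀ {n} → Expr n → Expr n → Expr n
[ x , y ] = x ′ · y ′ · x · y

-- Normal forms are freely reduced words; a letter is a variable (flag
-- true) or the inverse of one (flag false).
Letter : ℕ → Set
Letter n = Bool × Fin n

cons : ∀ {n} → Letter n → List (Letter n) → List (Letter n)
cons x [] = x ∷ []
cons (b , i) ((b′ , j) ∷ w) with b Bool.≟ not b′ | i Fin.≟ j
... | yes _ | yes _ = w
... | _     | _     = (b , i) ∷ (b′ , j) ∷ w

append : ∀ {n} → List (Letter n) → List (Letter n) → List (Letter n)
append w₁ w₂ = foldr cons w₂ w₁

invert : ∀ {n} → List (Letter n) → List (Letter n)
invert []            = []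
invert ((b , i) ∷ w) = append (invert w) ((not b , i) ∷ [])

normalise : ∀ {n} → Expr n → List (Letter n)
normalise (var i) = (true , i) ∷ []
normalise one     = []
normalise (a · b) = append (normalise a) (normalise b)
normalise (a ′)   = invert (normalise a)

module GroupWords {c ℓ} (G : Group c ℓ) where
  open Group G
  open import Algebra.Properties.Group G using (ε⁻¹≈ε; ⁻¹-involutive; ⁻¹-anti-homo-∙)

  ⟦_⟧ : ∀ {n} → Expr n → Vec Carrier n → Carrier
  ⟦ var i ⟧ ρ = lookup ρ i
  ⟦ one ⟧   ρ = ε
  ⟦ a · b ⟧ ρ = ⟦ a ⟧ ρ ∙ ⟦ b ⟧ ρ
  ⟦ a ′ ⟧   ρ = ⟦ a ⟧ ρ ⁻¹

  ⟦_⟧ˡ : ∀ {n} → Letter n → Vec Carrier n → Carrier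
  ⟦ true  , i ⟧ˡ ρ = lookup ρ i
  ⟦ false , i ⟧ˡ ρ = lookup ρ i ⁻¹

  ⟦_⟧ʷ : ∀ {n} → List (Letter n) → Vec Carrier n → Carrier
  ⟦ [] ⟧ʷ    ρ = ε
  ⟦ x ∷ w ⟧ʷ ρ = ⟦ x ⟧ˡ ρ ∙ ⟦ w ⟧ʷ ρ

  ⟦not⟧ : ∀ {n} b (i : Fin n) ρ → ⟦ not b , i ⟧ˡ ρ ≈ ⟦ b , i ⟧ˡ ρ ⁻¹
  ⟦not⟧ true  i ρ = refl
  ⟦not⟧ false i ρ = sym (⁻¹-involutive _)

  cancel : ∀ {n} b (i : Fin n) w ρ → ⟦ not b , i ⟧ˡ ρ ∙ (⟦ b , i ⟧ˡ ρ ∙ ⟦ w ⟧ʷ ρ) ≈ ⟦ w ⟧ʷ ρ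
  cancel b i w ρ = trans (sym (assoc _ _ _)) (trans (∙-cong inverse-pair refl) (identityˡ _))
    where
    inverse-pair : ⟦ not b , i ⟧ˡ ρ ∙ ⟦ b , i ⟧ˡ ρ ≈ ε
    inverse-pair = trans (∙-cong (⟦not⟧ b i ρ) refl) (inverseˡ _)

  cons-sound : ∀ {n} x (w : List (Letter n)) ρ → ⟦ cons x w ⟧ʷ ρ ≈ ⟦ x ⟧ˡ ρ ∙ ⟦ w ⟧ʷ ρ
  cons-sound x [] ρ = refl
  cons-sound (b , i) ((b′ , j) ∷ w) ρ with b Bool.≟ not b′ | i Fin.≟ j
  ... | yes P.refl | yes P.refl = sym (cancel b′ i w ρ)
  ... | yes _      | no _       = refl
  ... | no _       | _          = refl

  append-sound : ∀ {n} (w₁ w₂ : List (Letter n)) ρ → ⟦ append w₁ w₂ ⟧ʷ ρ ≈ ⟦ w₁ ⟧ʷ ρ ∙ ⟦ w₂ ⟧ʷ ρ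
  append-sound []       w₂ ρ = sym (identityˡ _)
  append-sound (x ∷ w₁) w₂ ρ =
    trans (cons-sound x (append w₁ w₂) ρ)
          (trans (∙-cong refl (append-sound w₁ w₂ ρ)) (sym (assoc _ _ _)))

  invert-sound : ∀ {n} (w : List (Letter n)) ρ → ⟦ invert w ⟧ʷ ρ ≈ ⟦ w ⟧ʷ ρ ⁻¹
  invert-sound []            ρ = sym ε⁻¹≈ε
  invert-sound ((b , i) ∷ w) ρ =
    trans (append-sound (invert w) _ ρ)
          (trans (∙-cong (invert-sound w ρ) (trans (identityʳ _) (⟦not⟧ b i ρ)))
                 (sym (⁻¹-anti-homo-∙ _ _)))

  normalise-sound : ∀ {n} (a : Expr n) ρ → ⟦ a ⟧ ρ ≈ ⟦ normalise a ⟧ʷ ρ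
  normalise-sound (var i) ρ = sym (identityʳ _)
  normalise-sound one     ρ = refl
  normalise-sound (a · b) ρ =
    trans (∙-cong (normalise-sound a ρ) (normalise-sound b ρ))
          (sym (append-sound (normalise a) (normalise b) ρ))
  normalise-sound (a ′)   ρ =
    trans (⁻¹-cong (normalise-sound a ρ)) (sym (invert-sound (normalise a) ρ))

  solve : ∀ {n} (a b : Expr n) → normalise a ≡ normalise b → ∀ ρ → ⟦ a ⟧ ρ ≈ ⟦ b ⟧ ρ
  solve a b same ρ =
    trans (normalise-sound a ρ)
          (trans (reflexive (cong (λ w → ⟦ w ⟧ʷ ρ) same)) (sym (normalise-sound b ρ)))

module IndexArithmetic {o r} (I : Ordering o r) where
  open Ordering I renaming (Carrier to Idx; _+_ to _⊕_)

  indexSemigroup : CommutativeSemigroup o o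
  indexSemigroup = record
    { Carrier = Idx
    ; _≈_ = _≡_
    ; _∙_ = _⊕_
    ; isCommutativeSemigroup = record
      { isSemigroup = record
        { isMagma = record { isEquivalence = P.isEquivalence ; ∙-cong = cong₂ _⊕_ }
        ; assoc = +-assoc
        }
      ; comm = +-comm
      }
    }
  open import Algebra.Properties.CommutativeSemigroup indexSemigroup public
    using (xy∙z≈y∙xz; xy∙z≈yz∙x; x∙yz≈xz∙y)

  +-identityʳ : ∀ i → i ⊕ 0# ≡ i
  +-identityʳ i = P.trans (+-comm i 0#) (+-identityˡ i)

  ≼-⊕ʳ : ∀ i j → i ≼ i ⊕ j
  ≼-⊕ʳ i j = subst₂ _≼_ (+-identityˡ i) (+-comm j i) (+-mono i (0-minimal j))

  indexSum-∷ʳ : ∀ {a} {A : Set a} (L : List (Idx × A)) i h →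
                indexSum I (L ∷ʳ (i , h)) ≡ indexSum I L ⊕ i
  indexSum-∷ʳ []             i h = P.trans (+-identityʳ i) (P.sym (+-identityˡ i))
  indexSum-∷ʳ ((j , _) ∷ L)  i h = P.trans (cong (j ⊕_) (indexSum-∷ʳ L i h)) (P.sym (+-assoc j _ i))

module FilteredMaps {o r c₁ ℓ₁ c₂ ℓ₂ p₁ p₂ : Level} (I : Ordering o r)
  (H : Group c₁ ℓ₁) (G : Group c₂ ℓ₂) (FH : Filtration I H p₁) (FG : Filtration I G p₂) where
  open Ordering I renaming (Carrier to Idx; _+_ to _⊕_)
  open IndexArithmetic I
  private
    module H = Group H
    module G = Group G
    module HW = GroupWords H
    module GW = GroupWords G

  H[_] : Idx → Pred H.Carrier p₁
  H[_] = Filtration.F FH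
  G[_] : Idx → Pred G.Carrier p₂
  G[_] = Filtration.F FG
  module Hˢ (i : Idx) = IsSubgroup (Filtration.isSubgroup FH i)
  module Gˢ (i : Idx) = IsSubgroup (Filtration.isSubgroup FG i)

  Map : Set (c₁ ⊔ c₂)
  Map = H.Carrier → G.Carrier

  Congruent : Map → Set (c₁ ⊔ ℓ₁ ⊔ ℓ₂)
  Congruent f = ∀ {x y} → x H.≈ y → f x G.≈ f y

  Pointwise : Map → Map → Set (c₁ ⊔ ℓ₂)
  Pointwise f f′ = ∀ n → f n G.≈ f′ n

  ∂-pointwise : ∀ h {f f′} → Pointwise f f′ → Pointwise (∂ H G h f) (∂ H G h f′)
  ∂-pointwise h f≈f′ n = G.∙-cong (f≈f′ _) (G.⁻¹-cong (f≈f′ n))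

  ∂-congruent : ∀ h {f} → Congruent f → Congruent (∂ H G h f)
  ∂-congruent h cong-f x≈y = G.∙-cong (cong-f (H.∙-cong H.refl x≈y)) (G.⁻¹-cong (cong-f x≈y))

  Values : Idx → Map → Set (c₁ ⊔ p₁ ⊔ p₂)
  Values t f = ∀ n → H[ 0# ] n → G[ t ] (f n)

  Poly : ∀ {q} → (Idx → Pred H.Carrier q) → ℕ → Idx → Map → Set (o ⊔ c₁ ⊔ p₁ ⊔ p₂ ⊔ q)
  Poly S zero    t f = ⊤
  Poly S (suc m) t f = Values t f × (∀ i h → S i h → Poly S m (t ⊕ i) (∂ H G h f))

  module Closure {q} (S : Idx → Pred H.Carrier q) where

    poly-lower : ∀ m {t f} → Poly S (suc m) t f → Poly S m t f
    poly-lower zero    p = tt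
    poly-lower (suc m) (vals , deriv) = vals , λ i h s → poly-lower m (deriv i h s)

    poly-pointwise : ∀ m {t f f′} → Pointwise f f′ → Poly S m t f → Poly S m t f′
    poly-pointwise zero    f≈f′ p = tt
    poly-pointwise (suc m) {t} f≈f′ (vals , deriv) =
      (λ n n₀ → Gˢ.resp t (f≈f′ n) (vals n n₀)) ,
      λ i h s → poly-pointwise m (∂-pointwise h f≈f′) (deriv i h s)

    poly-weaken : ∀ m {t t′ f} → t′ ≼ t → Poly S m t f → Poly S m t′ f
    poly-weaken zero    t′≼t p = tt
    poly-weaken (suc m) t′≼t (vals , deriv) =
      (λ n n₀ → Filtration.antitone FG t′≼t (vals n n₀)) ,
      λ i h s → poly-weaken m (+-mono i t′≼t) (deriv i h s)

    poly-reindex : ∀ m {t t′ f} → t ≡ t′ → Poly S m t f → Poly S m t′ f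
    poly-reindex m P.refl p = p

    poly-ε : ∀ m {t} → Poly S m t (λ _ → G.ε)
    poly-ε zero        = tt
    poly-ε (suc m) {t} =
      (λ n n₀ → Gˢ.ε∈ t) , λ i h s → poly-pointwise m (λ n → G.sym (G.inverseʳ G.ε)) (poly-ε m)

    -- Closure under the group operations, by the derivative rules (∂ = ∂_h)
    --   ∂(f₁f₂) = ∂f₁ · ∂f₂ · [∂f₂ , f₁⁻¹]
    --   ∂(f⁻¹)  = (∂f)⁻¹ · [(∂f)⁻¹ , f]
    --   ∂[X,C]  = E · [E , C X],  where W = [(∂C)⁻¹ , ∂X] and
    --             E = [C⁻¹ , ∂X] · (W · [W , ∂C]) · [∂C , X⁻¹].
    -- Every factor on the right has shift at least that of ∂ of the left,
    -- so closure at depth m+1 follows from closure at depth m.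
    poly-∙          : ∀ m {s f₁ f₂} → Poly S m s f₁ → Poly S m s f₂ → Poly S m s (λ n → f₁ n G.∙ f₂ n)
    poly-⁻¹         : ∀ m {s f} → Poly S m s f → Poly S m s (λ n → f n G.⁻¹)
    poly-commutator : ∀ m {a b X C} → Poly S m a X → Poly S m b C →
                      Poly S m (a ⊕ b) (λ n → commutator G (X n) (C n))

    poly-∙ zero p q = tt
    poly-∙ (suc m) {s} {f₁} {f₂} p q =
      (λ n n₀ → Gˢ.∙∈ s (proj₁ p n n₀) (proj₁ q n n₀)) , λ i h hˢ →
        let ∂f₁ = proj₂ p i h hˢ
            ∂f₂ = proj₂ q i h hˢ
            twist = poly-weaken m (≼-⊕ʳ (s ⊕ i) s) (poly-commutator m ∂f₂ (poly-⁻¹ m (poly-lower m p)))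
        in poly-pointwise m
             (λ n → GW.solve (x₀ · x₂ ′ · (x₁ · x₃ ′ · [ x₁ · x₃ ′ , x₂ ′ ])) ((x₀ · x₁) · (x₂ · x₃) ′) P.refl
                      (f₁ (h H.∙ n) ∷ f₂ (h H.∙ n) ∷ f₁ n ∷ f₂ n ∷ []))
             (poly-∙ m ∂f₁ (poly-∙ m ∂f₂ twist))

    poly-⁻¹ zero p = tt
    poly-⁻¹ (suc m) {s} {f} p =
      (λ n n₀ → Gˢ.⁻¹∈ s (proj₁ p n n₀)) , λ i h hˢ →
        let ∂f⁻¹ = poly-⁻¹ m (proj₂ p i h hˢ)
            twist = poly-weaken m (≼-⊕ʳ (s ⊕ i) s) (poly-commutator m ∂f⁻¹ (poly-lower m p))
        in poly-pointwise m
             (λ n → GW.solve ((x₀ · x₁ ′) ′ · [ (x₀ · x₁ ′) ′ , x₁ ]) (x₀ ′ · x₁ ′ ′) P.refl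
                      (f (h H.∙ n) ∷ f n ∷ []))
             (poly-∙ m ∂f⁻¹ twist)

    poly-commutator zero p q = tt
    poly-commutator (suc m) {a} {b} {X} {C} p q =
      (λ n n₀ → Filtration.commutators FG (proj₁ p n n₀) (proj₁ q n n₀)) , λ i h hˢ →
        let target = (a ⊕ b) ⊕ i
            ∂X = proj₂ p i h hˢ
            ∂C = proj₂ q i h hˢ
            X′ = poly-lower m p
            C′ = poly-lower m q
            t₁ = poly-reindex m (P.sym (xy∙z≈y∙xz a b i)) (poly-commutator m (poly-⁻¹ m C′) ∂X)
            V  = poly-reindex m (P.sym (xy∙z≈y∙xz a b i))
                   (poly-commutator m (poly-⁻¹ m (poly-weaken m (≼-⊕ʳ b i) ∂C)) ∂X)
            t₂ = poly-∙ m V (poly-weaken m (≼-⊕ʳ target (b ⊕ i)) (poly-commutator m V ∂C))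
            t₃ = poly-reindex m (P.sym (xy∙z≈yz∙x a b i)) (poly-commutator m ∂C (poly-⁻¹ m X′))
            E  = poly-∙ m (poly-∙ m t₁ t₂) t₃
            CX = poly-∙ m (poly-weaken m (0-minimal b) C′) (poly-weaken m (0-minimal a) X′)
        in poly-pointwise m
             (λ n → GW.solve
               (let u = x₀ · x₁ ′ ; v = x₂ · x₃ ′ ; w = [ v ′ , u ]
                    e = [ x₃ ′ , u ] · (w · [ w , v ]) · [ v , x₁ ′ ]
                in e · [ e , x₃ · x₁ ])
               ([ x₀ , x₂ ] · [ x₁ , x₃ ] ′) P.refl
               (X (h H.∙ n) ∷ X n ∷ C (h H.∙ n) ∷ C n ∷ []))
             (poly-∙ m E (poly-weaken m (≼-⊕ʳ target 0#) (poly-commutator m E CX)))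

  open Closure

  -- Translating the argument by k ∈ H₀ preserves polynomiality along all of
  -- H: ∂_a (F(k ·)) = (∂_{k a k⁻¹} F)(k ·), and k a k⁻¹ = a [a , k⁻¹] ∈ H_i.
  poly-translate : ∀ m {t F} → Congruent F → ∀ {k} → H[ 0# ] k →
                   Poly H[_] m t F → Poly H[_] m t (λ n → F (k H.∙ n))
  poly-translate zero    cong-F k₀ p = tt
  poly-translate (suc m) {t} {F} cong-F {k} k₀ (vals , deriv) =
    (λ n n₀ → vals _ (Hˢ.∙∈ 0# k₀ n₀)) , λ i a aᵢ →
      poly-pointwise H[_] m
        (λ n → G.∙-cong (cong-F (HW.solve ((x₀ · x₁ · x₀ ′) · (x₀ · x₂)) (x₀ · (x₁ · x₂)) P.refl (k ∷ a ∷ n ∷ [])))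
                        G.refl)
        (poly-translate m (∂-congruent _ cong-F) k₀ (deriv i _ (conjugate∈ aᵢ)))
    where
    conjugate∈ : ∀ {i a} → H[ i ] a → H[ i ] (k H.∙ a H.∙ k H.⁻¹)
    conjugate∈ {i} {a} aᵢ =
      Hˢ.resp i (HW.solve (x₁ · [ x₁ , x₀ ′ ]) (x₀ · x₁ · x₀ ′) P.refl (k ∷ a ∷ []))
        (Hˢ.∙∈ i aᵢ (subst (λ j → H[ j ] _) (+-identityʳ i)
                        (Filtration.commutators FH aᵢ (Hˢ.⁻¹∈ 0# k₀))))

  poly-generated : ∀ {q} (E : Idx → Pred H.Carrier q) → (∀ i → Generates H (E i) H[ i ]) →
                   ∀ m {t f} → Congruent f → Poly E m t f → Poly H[_] m t f
  poly-generated E E-gen zero    cong-f p = tt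
  poly-generated E E-gen (suc m) {t} {f} cong-f (vals , deriv) =
    vals , λ i h hᵢ → along i (proj₁ (E-gen i) hᵢ)
    where
    in-H₀ : ∀ {i x} → Generated H (E i) x → H[ 0# ] x
    in-H₀ {i} x∈ = Filtration.antitone FH (0-minimal i) (proj₂ (E-gen i) x∈)

    along : ∀ i {h} → Generated H (E i) h → Poly H[_] m (t ⊕ i) (∂ H G h f)
    along i (gen e) = poly-generated E E-gen m (∂-congruent _ cong-f) (deriv i _ e)
    along i unit =
      poly-pointwise H[_] m
        (λ n → G.sym (G.trans (G.∙-cong (cong-f (H.identityˡ n)) G.refl) (G.inverseʳ _)))
        (poly-ε H[_] m)
    -- ∂_{xy} f = (∂_x f)(y ·) · ∂_y f
    along i (mul {x} {y} x∈ y∈) =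
      poly-pointwise H[_] m
        (λ n → G.trans (GW.solve (x₀ · x₁ ′ · (x₁ · x₂ ′)) (x₀ · x₂ ′) P.refl
                          (f (x H.∙ (y H.∙ n)) ∷ f (y H.∙ n) ∷ f n ∷ []))
                       (G.∙-cong (cong-f (H.sym (H.assoc x y n))) G.refl))
        (poly-∙ H[_] m (poly-translate m (∂-congruent x cong-f) (in-H₀ y∈) (along i x∈)) (along i y∈))
    -- ∂_{x⁻¹} f = ((∂_x f)(x⁻¹ ·))⁻¹
    along i (inv {x} x∈) =
      poly-pointwise H[_] m
        (λ n → G.trans (G.⁻¹-cong (G.∙-cong (cong-f (HW.solve (x₀ · (x₀ ′ · x₁)) x₁ P.refl (x ∷ n ∷ []))) G.refl))
                       (GW.solve ((x₀ · x₁ ′) ′) (x₁ · x₀ ′) P.refl (f n ∷ f (x H.⁻¹ H.∙ n) ∷ [])))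
        (poly-⁻¹ H[_] m (poly-translate m (∂-congruent x cong-f) (Hˢ.⁻¹∈ 0# (in-H₀ x∈)) (along i x∈)))
    along i (resp x≈y x∈) = poly-pointwise H[_] m (λ n → G.∙-cong (cong-f (H.∙-cong x≈y H.refl)) G.refl) (along i x∈)

  Deriv : ∀ {q} → (Idx → Pred H.Carrier q) → Idx → Map → Set (o ⊔ c₁ ⊔ p₁ ⊔ p₂ ⊔ q)
  Deriv S t f = ∀ (L : List (Idx × H.Carrier)) → All (λ ih → S (proj₁ ih) (proj₂ ih)) L →
                ∀ n → H[ 0# ] n → G[ t ⊕ indexSum I L ] (∂s H G L f n)

  Deriv-0# : ∀ {q} {S : Idx → Pred H.Carrier q} {g} → DerivCondition I FH FG S g ⇔ Deriv S 0# g
  Deriv-0# {g = g} = mk⇔ (λ D L Lˢ n n₀ → shift L n (P.sym (+-identityˡ _)) (D L Lˢ n n₀))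
                         (λ D L Lˢ n n₀ → shift L n (+-identityˡ _) (D L Lˢ n n₀))
    where
    shift : ∀ L n {j j′} → j ≡ j′ → G[ j ] (∂s H G L g n) → G[ j′ ] (∂s H G L g n)
    shift L n = subst (λ j → G[ j ] (∂s H G L g n))

  ∂s-∷ʳ : ∀ (L : List (Idx × H.Carrier)) i h f → ∂s H G (L ∷ʳ (i , h)) f ≡ ∂s H G L (∂ H G h f)
  ∂s-∷ʳ []            i h f = P.refl
  ∂s-∷ʳ ((_ , x) ∷ L) i h f = cong (∂ H G x) (∂s-∷ʳ L i h f)

  snoc-transport : ∀ L i h f t n →
    G[ t ⊕ indexSum I (L ∷ʳ (i , h)) ] (∂s H G (L ∷ʳ (i , h)) f n) ⇔
    G[ (t ⊕ i) ⊕ indexSum I L ] (∂s H G L (∂ H G h f) n)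
  snoc-transport L i h f t n =
    mk⇔ (subst₂ G[_] index derivative) (subst₂ G[_] (P.sym index) (P.sym derivative))
    where
    index : t ⊕ indexSum I (L ∷ʳ (i , h)) ≡ (t ⊕ i) ⊕ indexSum I L
    index = P.trans (cong (t ⊕_) (indexSum-∷ʳ L i h)) (x∙yz≈xz∙y t (indexSum I L) i)
    derivative : ∂s H G (L ∷ʳ (i , h)) f n ≡ ∂s H G L (∂ H G h f) n
    derivative = cong-app (∂s-∷ʳ L i h f) n

  module _ {q} {S : Idx → Pred H.Carrier q} where

    deriv-step : ∀ {t f i h} → Deriv S t f → S i h → Deriv S (t ⊕ i) (∂ H G h f)
    deriv-step {t} {f} {i} {h} D hˢ L Lˢ n n₀ =
      to (snoc-transport L i h f t n) (D (L ∷ʳ (i , h)) (∷ʳ⁺ Lˢ hˢ) n n₀)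

    deriv→poly : ∀ m {t f} → Deriv S t f → Poly S m t f
    deriv→poly zero    D = tt
    deriv→poly (suc m) {t} {f} D =
      (λ n n₀ → subst (λ j → G[ j ] (f n)) (+-identityʳ t) (D [] [] n n₀)) ,
      λ i h hˢ → deriv→poly m (deriv-step D hˢ)

    -- conversely, the derivative along L is controlled by Poly at depth
    -- length L + 1, peeling the directions off L from the right
    poly→deriv : ∀ {t f} → (∀ m → Poly S m t f) → Deriv S t f
    poly→deriv all-depths L = along (reverseView L) all-depths
      where
      along : ∀ {L t f} → Reverse L → (∀ m → Poly S m t f) → All (λ ih → S (proj₁ ih) (proj₂ ih)) L →
              ∀ n → H[ 0# ] n → G[ t ⊕ indexSum I L ] (∂s H G L f n)
      along {t = t} {f} [] all-depths [] n n₀ =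
        subst (λ j → G[ j ] (f n)) (P.sym (+-identityʳ t)) (proj₁ (all-depths 1) n n₀)
      along {t = t} {f} (L ∶ rs ∶ʳ (i , h)) all-depths Lˢ n n₀ =
        let Lˢ′ , hˢ = ∷ʳ⁻ Lˢ
        in from (snoc-transport L i h f t n)
                (along rs (λ m → proj₂ (all-depths (suc m)) i h hˢ) Lˢ′ n n₀)

propositionB8 : ∀ {o r c₁ ℓ₁ c₂ ℓ₂ p₁ p₂ q : Level}
    (I : Ordering o r) (H : Group c₁ ℓ₁) (G : Group c₂ ℓ₂)
    (FH : Filtration I H p₁) (FG : Filtration I G p₂)
    (E : Ordering.Carrier I → Pred (Group.Carrier H) q)
    (E-gen : ∀ i → Generates H (E i) (Filtration.F FH i))
    (g : Group.Carrier H → Group.Carrier G)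
    (g-cong : ∀ {x y} → Group._≈_ H x y → Group._≈_ G (g x) (g y)) →
    IsPolynomial I FH FG g ⇔ DerivCondition I FH FG E g
propositionB8 I H G FH FG E E-gen g g-cong = mk⇔ restrict extend
  where
  open FilteredMaps I H G FH FG
  -- generators of H_i lie in H_i
  restrict : IsPolynomial I FH FG g → DerivCondition I FH FG E g
  restrict P L Lᴱ = P L (All-map (λ e → proj₂ (E-gen _) (gen e)) Lᴱ)

  -- the condition along E gives Poly E at every depth, hence Poly H, hence
  -- the condition along H
  extend : DerivCondition I FH FG E g → IsPolynomial I FH FG g
  extend D = from Deriv-0# (poly→deriv (λ m →
               poly-generated E E-gen m g-cong (deriv→poly m (to Deriv-0# D))))
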